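{- Let $R,S$ be finite digraphs, $\mathfrak{D}'$ a class of finite digraphs, and $\mathfrak{G}_{\mathfrak{D}'}(R)=\{\mathcal{G}(\xi):\xi\in\mathcal{H}(G,R), G\in\mathfrak{D}'\}$. If $\#\mathcal{S}(G,R)\le\#\mathcal{S}(G,S)$ for all $G\in\mathfrak{G}_{\mathfrak{D}'}(R)$, then $R\sqsubseteq_\Gamma S$ with respect to $\mathfrak{D}'$.
   Context: Digraphs $G=(V(G),A(G))$: finite non-empty $V(G)$, $A(G)\subseteq V(G)\times V(G)$; proper arcs $vw$ with $v\ne w$; $G^*$ is $G$ without loops. $\mathcal{H}(G,H)$: homomorphisms (maps with $\xi(v)\xi(w)\in A(H)$ for $vw\in A(G)$); $\mathcal{S}(G,H)$: strict homomorphisms (homomorphisms mapping proper arcs to proper arcs). $v,w$ adjacent if $vw$ or $wv$ is an arc. For $X\subseteq V(G)$, $v\in X$, $\gamma_X(v)$ = set of $w\in X$ equal to $v$ or joined to $v$ by a sequence in $X$ of consecutively adjacent vertices; $\Gamma_\xi(v)=\gamma_{\xi^{ -1}(\xi(v))}(v)$. For $\xi\in\mathcal{H}(G,H)$, $\mathcal{G}(\xi)$ has vertex set $\{\Gamma_\xi(v): v\in V(G)\}$ and arcs $(\mathfrak{a},\mathfrak{b})$ whenever some $a\in\mathfrak{a}$, $b\in\mathfrak{b}$ satisfy $ab\in A(G)$. $R\sqsubseteq_\Gamma S$ w.r.t. $\mathfrak{D}'$ means: for a representative system $\mathfrak{D}'_r$ of $\mathfrak{D}'$ up to isomorphism there exist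 injective maps $\rho_G:\mathcal{H}(G,R)\to\mathcal{H}(G,S)$, $G\in\mathfrak{D}'_r$, with $\Gamma_{\rho_G(\xi)}(v)=\Gamma_\xi(v)$ for all $G\in\mathfrak{D}'_r$, $\xi\in\mathcal{H}(G,R)$, $v\in V(G)$. -}

module Defs where

open import Data.Nat using (ℕ; zero; suc; _≤_)
open import Data.Fin using (Fin; zero; suc; _≟_)
open import Data.Fin.Properties using (all?)
open import Data.Bool using (Bool; T)
open import Data.Bool.Properties using (T?)
open import Data.List using (List; []; _∷_; length; filter; concatMap; map; allFin)
open import Data.Product using (Σ; ∃; _×_; _,_; proj₁; proj₂)
open import Data.Sum using (_⊎_)
open import Data.Vec.Functional using () renaming (_∷_ to _∷ᶠ_)
open import Relation.Nullary using (Dec; ¬_; ¬?)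
open import Relation.Nullary.Decidable using (_×-dec_; _→-dec_)
open import Relation.Binary.PropositionalEquality using (_≡_; _≢_; _≗_)
open import Function using (_⇔_)

-- A finite digraph with non-empty vertex set Fin (suc size);
-- the arc set is given by a Boolean adjacency matrix (loops allowed).
record Digraph : Set where
  field
    size : ℕ
    arc  : Fin (suc size) → Fin (suc size) → Bool

V : Digraph → Set
V G = Fin (suc (Digraph.size G))

Arc : (G : Digraph) → V G → V G → Set
Arc G v w = T (Digraph.arc G v w)

IsHom : (G H : Digraph) → (V G → V H) → Set
IsHom G H ξ = ∀ v w → Arc G v w → Arc H (ξ v) (ξ w)

IsStrictHom : (G H : Digraph) → (V G → V H) → Set
IsStrictHom G H ξ = IsHom G H ξ × (∀ v w → v ≢ w → Arc G v w → ξ v ≢ ξ w)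

Hom : Digraph → Digraph → Set
Hom G H = Σ (V G → V H) (IsHom G H)

isStrictHom? : (G H : Digraph) (ξ : V G → V H) → Dec (IsStrictHom G H ξ)
isStrictHom? G H ξ =
  all? (λ v → all? (λ w → T? (Digraph.arc G v w) →-dec T? (Digraph.arc H (ξ v) (ξ w))))
  ×-dec
  all? (λ v → all? (λ w → ¬? (v ≟ w) →-dec (T? (Digraph.arc G v w) →-dec ¬? (ξ v ≟ ξ w))))

allFuns : ∀ n m → List (Fin n → Fin m)
allFuns zero    m = (λ ()) ∷ []
allFuns (suc n) m = concatMap (λ i → map (λ f → i ∷ᶠ f) (allFuns n m)) (allFin m)

#S : Digraph → Digraph → ℕ
#S G H = length (filter (isStrictHom? G H) (allFuns _ _))

Adjacent : (G : Digraph) → V G → V G → Set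
Adjacent G v w = Arc G v w ⊎ Arc G w v

data Reach (G : Digraph) (X : V G → Set) (v : V G) : V G → Set where
  here : Reach G X v v
  step : ∀ {u w} → Reach G X v u → Adjacent G u w → X w → Reach G X v w

γ : (G : Digraph) (X : V G → Set) → V G → V G → Set
γ G X v w = X w × Reach G X v w

Γ : (G H : Digraph) (ξ : V G → V H) → V G → V G → Set
Γ G H ξ v w = γ G (λ u → ξ u ≡ ξ v) v w

-- K is (an isomorphic copy of) 𝒢(ξ): π sends v to the vertex representing Γ_ξ(v),
-- π is onto, π v ≡ π w iff Γ_ξ(v) = Γ_ξ(w) as sets, and the arcs are exactly as in 𝒢(ξ).
IsGraphOf : (G H : Digraph) (ξ : V G → V H) (K : Digraph) → Set
IsGraphOf G H ξ K =
  Σ (V G → V K) λ π →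
    (∀ a → ∃ λ v → π v ≡ a)
    × (∀ v w → (π v ≡ π w) ⇔ (∀ u → Γ G H ξ v u ⇔ Γ G H ξ w u))
    × (∀ a b → Arc K a b ⇔ (∃ λ v → ∃ λ w → π v ≡ a × π w ≡ b × Arc G v w))

_⊑Γ_wrt_ : Digraph → Digraph → (Digraph → Set) → Set
R ⊑Γ S wrt D =
  ∀ G → D G →
    Σ (Hom G R → Hom G S) λ ρ →
      (∀ ξ ξ′ → proj₁ (ρ ξ) ≗ proj₁ (ρ ξ′) → proj₁ ξ ≗ proj₁ ξ′)
      × (∀ ξ v u → Γ G S (proj₁ (ρ ξ)) v u ⇔ Γ G R (proj₁ ξ) v u)

-- For ξ : G → R, a map f : G → H has the same Γ-partition as ξ exactly when f and ξ identify the same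
-- adjacent pairs of vertices. Composing with the quotient map G → 𝒢(ξ) matches such homomorphisms
-- f : G → H bijectively with the strict homomorphisms 𝒢(ξ) → H. So the hypothesis says that each class
-- of H(G,R) under "same Γ-partition" is at most as large as the corresponding class of H(G,S). Listing
-- both classes, ρ sends the i-th member of the first to the i-th member of the second: it preserves Γ,
-- and it is injective because the two lists depend only on the class.

module Submission where

open import Defs
open import Data.Nat using (ℕ; zero; suc; _≤_; z≤n; s≤s)
open import Data.Nat.Properties using (≤-refl; ≤-antisym; <-≤-trans; ≤-pred; n≮0; module ≤-Reasoning)
open import Data.Fin using (Fin; zero; suc; _≟_; inject≤) renaming (_≤_ to _≤ᶠ_)
open import Data.Fin.Properties using (any?; all?; injective⇒≤; inject≤-injective)
  renaming (≤-antisym to ≤ᶠ-antisym)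
open import Data.Fin.Subset using (Subset; _-_; ⁅_⁆; ⊤; ∣_∣) renaming (_∈_ to _∈ₛ_)
open import Data.Fin.Subset.Properties using (x∈p∧x≢y⇒x∈p-y; x∈p⇒∣p-x∣<∣p∣; p─q⊆p; ∈⊤)
  renaming (_∈?_ to _∈ₛ?_)
open import Data.Bool.Properties using (T?)
open import Data.List using (List; []; _∷_; length; lookup; filter; map; concatMap;
  cartesianProductWith; allFin; tabulate; _++_)
open import Data.List.Properties using (filter-≐)
open import Data.List.Relation.Unary.Any using (here; there; index)
open import Data.List.Relation.Unary.Any.Properties using (lookup-index)
import Data.List.Relation.Unary.All as All
open All using ([]; _∷_)
open import Data.List.Relation.Unary.All.Properties using (all-filter) renaming (filter⁺ to All-filter⁺)
open import Data.List.Relation.Unary.AllPairs using ([]; _∷_)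
open import Data.List.Relation.Unary.Unique.Setoid using (Unique)
open import Data.List.Relation.Unary.Unique.Setoid.Properties using (cartesianProductWith⁺; filter⁺)
open import Data.List.Relation.Unary.Unique.Propositional.Properties using (allFin⁺)
import Data.List.Relation.Unary.Unique.Propositional.Properties as Uniqueₚ
import Data.List.Membership.Setoid as SetoidMembership
open import Data.List.Membership.Setoid.Properties using (index-injective; ∈-lookup; ∈-resp-≈;
  ∈-cartesianProductWith⁺; ∈-filter⁺; ∈-filter⁻)
open import Data.List.Membership.Propositional using () renaming (_∈_ to _∈ₚ_)
import Data.List.Membership.Propositional.Properties as ∈ₚ
open import Data.Product using (Σ; ∃; _×_; _,_; proj₁; proj₂)
open import Data.Sum using (_⊎_; inj₁; inj₂)
open import Data.Vec.Functional using () renaming (_∷_ to _∷ᶠ_)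
open import Function using (_∘_; _⇔_; mk⇔; Equivalence)
open import Function.Properties.Equivalence using () renaming (sym to ⇔-sym; trans to ⇔-trans)
open import Relation.Binary using (Setoid; Rel; IsDecEquivalence; _Respects_)
open import Relation.Binary.PropositionalEquality
open import Relation.Nullary using (Dec; yes; no; contradiction)
open import Relation.Nullary.Decidable
  using (_×-dec_; _⊎-dec_; _→-dec_; map′; isYes; toWitness; fromWitness)
open import Relation.Unary using (Pred; Decidable; _⊆_)
open import Level using (0ℓ)

open Equivalence using (to; from)

-- Injections between duplicate-free lists

module _ {a ℓ} (A : Setoid a ℓ) where
  open Setoid A using (_≈_) renaming (sym to ≈-sym)

  lookup-injective : ∀ {xs} → Unique A xs → ∀ {i j} → lookup xs i ≈ lookup xs j → i ≡ j
  lookup-injective (_ ∷ _)         {zero}  {zero}  _ = refl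
  lookup-injective (x≉xs ∷ _)      {zero}  {suc j} e = contradiction e       (All.lookup x≉xs (∈ₚ.∈-lookup j))
  lookup-injective (x≉xs ∷ _)      {suc i} {zero}  e = contradiction (≈-sym e) (All.lookup x≉xs (∈ₚ.∈-lookup i))
  lookup-injective (_ ∷ xs-unique) {suc i} {suc j} e = cong suc (lookup-injective xs-unique e)

module _ {a b ℓ₁ ℓ₂} (A : Setoid a ℓ₁) (B : Setoid b ℓ₂) where
  private
    module A = Setoid A
    module B = Setoid B
  open SetoidMembership A using () renaming (_∈_ to _∈ᴬ_)
  open SetoidMembership B using () renaming (_∈_ to _∈ᴮ_)

  injection⇒length-≤ : ∀ {xs ys} → Unique A xs → (f : A.Carrier → B.Carrier) →
    (∀ {x} → x ∈ᴬ xs → f x ∈ᴮ ys) →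
    (∀ {x y} → x ∈ᴬ xs → y ∈ᴬ xs → f x B.≈ f y → x A.≈ y) →
    length xs ≤ length ys
  injection⇒length-≤ {xs} xs-unique f f∈ f-injective = injective⇒≤ position-injective
    where
    position : Fin (length xs) → Fin _
    position i = index (f∈ (∈-lookup A xs i))
    position-injective : ∀ {i j} → position i ≡ position j → i ≡ j
    position-injective {i} {j} eq = lookup-injective A xs-unique
      (f-injective (∈-lookup A xs i) (∈-lookup A xs j) (index-injective B (f∈ _) (f∈ _) eq))

  embed : ∀ {xs x} (ys : List B.Carrier) → length xs ≤ length ys → x ∈ᴬ xs → B.Carrier
  embed ys xs≤ys x∈xs = lookup ys (inject≤ (index x∈xs) xs≤ys)

  embed-injective : ∀ {xs xs′ ys ys′ x y} → xs ≡ xs′ → ys ≡ ys′ → Unique B ys →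
    (xs≤ys : length xs ≤ length ys) (xs′≤ys′ : length xs′ ≤ length ys′)
    (x∈xs : x ∈ᴬ xs) (y∈xs′ : y ∈ᴬ xs′) →
    embed ys xs≤ys x∈xs B.≈ embed ys′ xs′≤ys′ y∈xs′ → x A.≈ y
  embed-injective refl refl ys-unique xs≤ys xs′≤ys′ x∈xs y∈xs′ e = index-injective A x∈xs y∈xs′
    (inject≤-injective xs≤ys xs′≤ys′ _ _ (lookup-injective B ys-unique e))

-- Counting maps Fin n → Fin m

concatMap-map≡cartesianProductWith : ∀ {A B C : Set} (f : A → B → C) xs ys →
  concatMap (λ x → map (f x) ys) xs ≡ cartesianProductWith f xs ys
concatMap-map≡cartesianProductWith f []       ys = refl
concatMap-map≡cartesianProductWith f (x ∷ xs) ys =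
  cong (map (f x) ys ++_) (concatMap-map≡cartesianProductWith f xs ys)

Maps : ℕ → ℕ → Setoid _ _
Maps n m = Fin n →-setoid Fin m

open module MapsMembership {n m} = SetoidMembership (Maps n m) using (_∈_)

allFuns-suc : ∀ n m → allFuns (suc n) m ≡ cartesianProductWith _∷ᶠ_ (allFin m) (allFuns n m)
allFuns-suc n m = concatMap-map≡cartesianProductWith _∷ᶠ_ (allFin m) (allFuns n m)

∷ᶠ-cong : ∀ {n m} {i j : Fin m} {f g : Fin n → Fin m} → i ≡ j → f ≗ g → (i ∷ᶠ f) ≗ (j ∷ᶠ g)
∷ᶠ-cong i≡j f≗g zero    = i≡j
∷ᶠ-cong i≡j f≗g (suc k) = f≗g k

∷ᶠ-injective : ∀ {n m} {i j : Fin m} {f g : Fin n → Fin m} → (i ∷ᶠ f) ≗ (j ∷ᶠ g) → i ≡ j × f ≗ g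
∷ᶠ-injective e = e zero , e ∘ suc

∈-allFuns : ∀ n m (f : Fin n → Fin m) → f ∈ allFuns n m
∈-allFuns zero    m f = here (λ ())
∈-allFuns (suc n) m f = subst (f ∈_) (sym (allFuns-suc n m))
  (∈-resp-≈ (Maps (suc n) m) head∷tail≗f
    (∈-cartesianProductWith⁺ (setoid (Fin m)) (Maps n m) (Maps (suc n) m) ∷ᶠ-cong
      (∈ₚ.∈-allFin (f zero)) (∈-allFuns n m (f ∘ suc))))
  where
  head∷tail≗f : (f zero ∷ᶠ f ∘ suc) ≗ f
  head∷tail≗f zero    = refl
  head∷tail≗f (suc i) = refl

allFuns-unique : ∀ n m → Unique (Maps n m) (allFuns n m)
allFuns-unique zero    m = [] ∷ []
allFuns-unique (suc n) m = subst (Unique (Maps (suc n) m)) (sym (allFuns-suc n m))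
  (cartesianProductWith⁺ (setoid (Fin m)) (Maps n m) (Maps (suc n) m) _∷ᶠ_ ∷ᶠ-injective
    (allFin⁺ m) (allFuns-unique n m))

filter-allFuns-unique : ∀ {n m ℓ} {P : Pred (Fin n → Fin m) ℓ} (P? : Decidable P) →
  Unique (Maps n m) (filter P? (allFuns n m))
filter-allFuns-unique {n} {m} P? = filter⁺ (Maps n m) P? (allFuns-unique n m)

#_ : ∀ {n m ℓ} {P : Pred (Fin n → Fin m) ℓ} → Decidable P → ℕ
# P? = length (filter P? (allFuns _ _))

module _ {n m ℓ} {P : Pred (Fin n → Fin m) ℓ} (P? : Decidable P) (P-resp : P Respects _≗_) where

  ∈-filter-allFuns : ∀ {f} → P f → f ∈ filter P? (allFuns n m)
  ∈-filter-allFuns Pf = ∈-filter⁺ (Maps n m) P? P-resp (∈-allFuns n m _) Pf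

  filter-allFuns-satisfies : ∀ {f} → f ∈ filter P? (allFuns n m) → P f
  filter-allFuns-satisfies f∈ = proj₂ (∈-filter⁻ (Maps n m) P? P-resp {xs = allFuns n m} f∈)

#-mono-injection : ∀ {a b c d ℓ ℓ′} {P : Pred (Fin a → Fin b) ℓ} {Q : Pred (Fin c → Fin d) ℓ′}
  (P? : Decidable P) (Q? : Decidable Q) → P Respects _≗_ → Q Respects _≗_ →
  (F : (Fin a → Fin b) → Fin c → Fin d) → (∀ {f} → P f → Q (F f)) →
  (∀ {f g} → P f → P g → F f ≗ F g → f ≗ g) → # P? ≤ # Q?
#-mono-injection {a} {b} {c} {d} P? Q? P-resp Q-resp F F-pres F-injective =
  injection⇒length-≤ (Maps a b) (Maps c d) (filter-allFuns-unique P?) F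
    (∈-filter-allFuns Q? Q-resp ∘ F-pres ∘ filter-allFuns-satisfies P? P-resp)
    (λ f∈ g∈ → F-injective (filter-allFuns-satisfies P? P-resp f∈)
                           (filter-allFuns-satisfies P? P-resp g∈))

-- Reachability and the Γ-partition

module _ (G : Digraph) where

  Adjacent-sym : ∀ {u w} → Adjacent G u w → Adjacent G w u
  Adjacent-sym (inj₁ uw) = inj₂ uw
  Adjacent-sym (inj₂ wu) = inj₁ wu

  adjacent? : ∀ u w → Dec (Adjacent G u w)
  adjacent? u w = T? (Digraph.arc G u w) ⊎-dec T? (Digraph.arc G w u)

  Reach-mono : ∀ {X Y : Pred (V G) 0ℓ} → X ⊆ Y → ∀ {v w} → Reach G X v w → Reach G Y v w
  Reach-mono X⊆Y here             = here
  Reach-mono X⊆Y (step r adj Xw) = step (Reach-mono X⊆Y r) adj (X⊆Y Xw)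

  Reach-trans : ∀ {X : Pred (V G) 0ℓ} {v u w} → Reach G X v u → Reach G X u w → Reach G X v w
  Reach-trans r here             = r
  Reach-trans r (step s adj Xw) = step (Reach-trans r s) adj Xw

  Reach-target : ∀ {X : Pred (V G) 0ℓ} {v w} → X v → Reach G X v w → X w
  Reach-target Xv here          = Xv
  Reach-target Xv (step _ _ Xw) = Xw

  Reach-target-≢ : ∀ {X : Pred (V G) 0ℓ} {v w} → v ≢ w → Reach G X v w → X w
  Reach-target-≢ v≢w here          = contradiction refl v≢w
  Reach-target-≢ v≢w (step _ _ Xw) = Xw

  Reach-sym : ∀ {X : Pred (V G) 0ℓ} {v w} → X v → Reach G X v w → Reach G X w v
  Reach-sym Xv here = here
  Reach-sym Xv (step r adj Xw) =
    Reach-trans (step here (Adjacent-sym adj) (Reach-target Xv r)) (Reach-sym Xv r)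

  module _ {X : Pred (V G) 0ℓ} (X? : Decidable X) where

    Within : Subset (suc (Digraph.size G)) → Pred (V G) 0ℓ
    Within p u = X u × u ∈ₛ p

    Within-mono : ∀ {p q} → (∀ {u} → u ∈ₛ p → u ∈ₛ q) → Within p ⊆ Within q
    Within-mono p⊆q (Xu , u∈p) = Xu , p⊆q u∈p

    avoid-or-enter : ∀ {p w v x} → Reach G (Within p) v x →
      Reach G (Within (p - w)) v x ⊎ ∃ λ u → Reach G (Within (p - w)) v u × Adjacent G u w
    avoid-or-enter here = inj₁ here
    avoid-or-enter {w = w} (step {u} {x} r adj (Xx , x∈p)) with avoid-or-enter r | x ≟ w
    ... | inj₂ entry | _        = inj₂ entry
    ... | inj₁ r′    | yes refl = inj₂ (u , r′ , adj)
    ... | inj₁ r′    | no x≢w   = inj₁ (step r′ adj (Xx , x∈p∧x≢y⇒x∈p-y x∈p x≢w))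

    first-entry : ∀ {p w v} → v ≢ w → Reach G (Within p) v w →
      ∃ λ u → Reach G (Within (p - w)) v u × Adjacent G u w
    first-entry v≢w r with avoid-or-enter r
    ... | inj₂ entry          = entry
    ... | inj₁ here           = contradiction refl v≢w
    ... | inj₁ (step r′ adj _) = _ , r′ , adj

    -- Cut a walk to w ≠ v at its first visit to w: it avoids w until one last step into w.
    reach-within-step : ∀ p → (∀ {w} → w ∈ₛ p → ∀ v u → Dec (Reach G (Within (p - w)) v u)) →
      ∀ v w → Dec (Reach G (Within p) v w)
    reach-within-step p reach-without? v w with v ≟ w | X? w ×-dec w ∈ₛ? p
    ... | yes refl | _                = yes here
    ... | no v≢w   | no ¬Xw∈p         = no (¬Xw∈p ∘ Reach-target-≢ v≢w)
    ... | no v≢w   | yes (Xw , w∈p)   =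
      map′ (λ (u , r , adj) → step (Reach-mono (Within-mono (p─q⊆p p ⁅ w ⁆)) r) adj (Xw , w∈p))
           (first-entry v≢w)
           (any? λ u → reach-without? w∈p v u ×-dec adjacent? u w)

    reach-within? : ∀ k p → ∣ p ∣ ≤ k → ∀ v w → Dec (Reach G (Within p) v w)
    reach-within? zero    p ∣p∣≤0 = reach-within-step p
      (λ w∈p → contradiction (<-≤-trans (x∈p⇒∣p-x∣<∣p∣ w∈p) ∣p∣≤0) n≮0)
    reach-within? (suc k) p ∣p∣≤k = reach-within-step p
      (λ w∈p → reach-within? k (p - _) (≤-pred (<-≤-trans (x∈p⇒∣p-x∣<∣p∣ w∈p) ∣p∣≤k)))

    reach? : ∀ v w → Dec (Reach G X v w)
    reach? v w = map′ (Reach-mono proj₁) (Reach-mono (_, ∈⊤)) (reach-within? _ ⊤ ≤-refl v w)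

module _ (G H : Digraph) (ξ : V G → V H) where

  Γ-refl : ∀ {v} → Γ G H ξ v v
  Γ-refl = refl , here

  Γ-sym : ∀ {v u} → Γ G H ξ v u → Γ G H ξ u v
  Γ-sym (ξu≡ξv , r) = sym ξu≡ξv , Reach-mono G (λ e → trans e (sym ξu≡ξv)) (Reach-sym G refl r)

  Γ-trans : ∀ {v u t} → Γ G H ξ v u → Γ G H ξ u t → Γ G H ξ v t
  Γ-trans (ξu≡ξv , r) (ξt≡ξu , s) =
    trans ξt≡ξu ξu≡ξv , Reach-trans G r (Reach-mono G (λ e → trans e ξu≡ξv) s)

  Γ-adjacent : ∀ {v w} → Adjacent G v w → ξ v ≡ ξ w → Γ G H ξ v w
  Γ-adjacent adj ξv≡ξw = sym ξv≡ξw , step here adj (sym ξv≡ξw)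

  Γ? : ∀ v u → Dec (Γ G H ξ v u)
  Γ? v u = ξ u ≟ ξ v ×-dec reach? G (λ t → ξ t ≟ ξ v) v u

  Γ-isDecEquivalence : IsDecEquivalence (Γ G H ξ)
  Γ-isDecEquivalence = record
    { isEquivalence = record { refl = Γ-refl ; sym = Γ-sym ; trans = Γ-trans }
    ; _≟_           = Γ?
    }

  Γ⇔same-class : ∀ {v w} → Γ G H ξ v w ⇔ (∀ u → Γ G H ξ v u ⇔ Γ G H ξ w u)
  Γ⇔same-class = mk⇔
    (λ Γvw u → mk⇔ (Γ-trans (Γ-sym Γvw)) (Γ-trans Γvw))
    (λ same → from (same _) Γ-refl)

-- The decidable, local form of Γ_f = Γ_g.
SameAdjacentKernel : (G : Digraph) {A B : Set} → (V G → A) → (V G → B) → Set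
SameAdjacentKernel G f g = ∀ v w → Adjacent G v w → f v ≡ f w ⇔ g v ≡ g w

module _ {G : Digraph} where

  SameAdjacentKernel-refl : ∀ {A} {f : V G → A} → SameAdjacentKernel G f f
  SameAdjacentKernel-refl v w adj = mk⇔ (λ e → e) (λ e → e)

  SameAdjacentKernel-sym : ∀ {A B} {f : V G → A} {g : V G → B} →
    SameAdjacentKernel G f g → SameAdjacentKernel G g f
  SameAdjacentKernel-sym f~g v w adj = ⇔-sym (f~g v w adj)

  SameAdjacentKernel-trans : ∀ {A B C} {f : V G → A} {g : V G → B} {h : V G → C} →
    SameAdjacentKernel G f g → SameAdjacentKernel G g h → SameAdjacentKernel G f h
  SameAdjacentKernel-trans f~g g~h v w adj = ⇔-trans (f~g v w adj) (g~h v w adj)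

  ≗⇒SameAdjacentKernel : ∀ {A} {f g : V G → A} → f ≗ g → SameAdjacentKernel G f g
  ≗⇒SameAdjacentKernel f≗g v w adj = mk⇔
    (λ e → trans (sym (f≗g v)) (trans e (f≗g w)))
    (λ e → trans (f≗g v) (trans e (sym (f≗g w))))

  sameAdjacentKernel? : ∀ {a b} (f : V G → Fin a) (g : V G → Fin b) → Dec (SameAdjacentKernel G f g)
  sameAdjacentKernel? f g = all? λ v → all? λ w → adjacent? G v w →-dec
    map′ (λ (fv≡fw⇒ , gv≡gw⇒) → mk⇔ fv≡fw⇒ gv≡gw⇒) (λ e → to e , from e)
         ((f v ≟ f w →-dec g v ≟ g w) ×-dec (g v ≟ g w →-dec f v ≟ f w))

  Γ-cong : ∀ {H H′} {ξ : V G → V H} {ζ : V G → V H′} → SameAdjacentKernel G ξ ζ →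
    ∀ {v u} → Γ G H ξ v u → Γ G H′ ζ v u
  Γ-cong {H′ = H′} {ξ} {ζ} ξ~ζ (_ , r) = along r
    where
    along : ∀ {v u} → Reach G (λ t → ξ t ≡ ξ v) v u → Γ G H′ ζ v u
    along here = refl , here
    along {v} (step {u} {x} r adj ξx≡ξv) with along r
    ... | ζu≡ζv , r′ = ζx≡ζv , step r′ adj ζx≡ζv
      where
      ζx≡ζv : ζ x ≡ ζ v
      ζx≡ζv = trans (sym (to (ξ~ζ u x adj) (trans (Reach-target G refl r) (sym ξx≡ξv)))) ζu≡ζv

-- Quotients of Fin (suc n) by a decidable equivalence

least : ∀ {n ℓ} {P : Pred (Fin n) ℓ} → Decidable P → ∃ P → ∃ λ i → P i × (∀ {j} → P j → i ≤ᶠ j)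
least {suc n} {P = P} P? (i , Pi) with P? zero
... | yes P0 = zero , P0 , λ _ → z≤n
... | no ¬P0 with i
...   | zero   = contradiction Pi ¬P0
...   | suc i′ with least (P? ∘ suc) (i′ , Pi)
...     | j , Pj , j-least = suc j , Pj , suc-j-least
  where
  suc-j-least : ∀ {k} → P k → suc j ≤ᶠ k
  suc-j-least {zero}  P0 = contradiction P0 ¬P0
  suc-j-least {suc k} Pk = s≤s (j-least Pk)

record Quotient {n ℓ} (_~_ : Rel (Fin (suc n)) ℓ) : Set ℓ where
  field
    size      : ℕ
    π         : Fin (suc n) → Fin (suc size)
    section   : Fin (suc size) → Fin (suc n)
    π∘section : ∀ a → π (section a) ≡ a
    π-≡⇔~     : ∀ {v w} → π v ≡ π w ⇔ v ~ w

module Representatives {n ℓ} {_~_ : Rel (Fin (suc n)) ℓ} (~-isDecEquivalence : IsDecEquivalence _~_) where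
  open IsDecEquivalence ~-isDecEquivalence
    renaming (refl to ~-refl; sym to ~-sym; trans to ~-trans; reflexive to ~-reflexive; _≟_ to _~?_)

  least-in-class : ∀ v → ∃ λ r → v ~ r × (∀ {u} → v ~ u → r ≤ᶠ u)
  least-in-class v = least (v ~?_) (v , ~-refl)

  rep : Fin (suc n) → Fin (suc n)
  rep v = proj₁ (least-in-class v)

  v~rep : ∀ v → v ~ rep v
  v~rep v = proj₁ (proj₂ (least-in-class v))

  rep-≤ : ∀ {v u} → v ~ u → rep v ≤ᶠ u
  rep-≤ {v} = proj₂ (proj₂ (least-in-class v))

  rep-cong : ∀ {v w} → v ~ w → rep v ≡ rep w
  rep-cong {v} {w} v~w = ≤ᶠ-antisym (rep-≤ (~-trans v~w (v~rep w))) (rep-≤ (~-trans (~-sym v~w) (v~rep v)))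

  rep-idem : ∀ v → rep (rep v) ≡ rep v
  rep-idem v = sym (rep-cong (v~rep v))

  rep-zero : rep zero ≡ zero
  rep-zero = ≤ᶠ-antisym (rep-≤ ~-refl) z≤n

  -- zero is always a representative; listing it first makes the number of classes visibly a successor.
  other-reps : List (Fin (suc n))
  other-reps = filter (λ r → rep r ≟ r) (tabulate suc)

  reps : List (Fin (suc n))
  reps = zero ∷ other-reps

  reps-fixed : All.All (λ r → rep r ≡ r) reps
  reps-fixed = rep-zero ∷ all-filter (λ r → rep r ≟ r) (tabulate suc)

  reps-unique : Unique (setoid _) reps
  reps-unique with allFin⁺ (suc n)
  ... | zero∉others ∷ others-unique =
    All-filter⁺ (λ r → rep r ≟ r) zero∉others ∷ Uniqueₚ.filter⁺ (λ r → rep r ≟ r) others-unique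

  ∈-reps : ∀ {r} → rep r ≡ r → r ∈ₚ reps
  ∈-reps {zero}  _     = here refl
  ∈-reps {suc r} fixed = there (∈ₚ.∈-filter⁺ (λ r → rep r ≟ r) (∈ₚ.∈-tabulate⁺ r) fixed)

  π : Fin (suc n) → Fin (length reps)
  π v = index (∈-reps (rep-idem v))

  lookup-π : ∀ v → lookup reps (π v) ≡ rep v
  lookup-π v = sym (lookup-index (∈-reps (rep-idem v)))

  π∘lookup : ∀ a → π (lookup reps a) ≡ a
  π∘lookup a = lookup-injective (setoid _) reps-unique
    (trans (lookup-π (lookup reps a)) (All.lookup reps-fixed (∈ₚ.∈-lookup a)))

  π-≡⇔~ : ∀ {v w} → π v ≡ π w ⇔ v ~ w
  π-≡⇔~ {v} {w} = mk⇔
    (λ πv≡πw → ~-trans (v~rep v) (~-trans (~-reflexive (rep-≡ πv≡πw)) (~-sym (v~rep w))))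
    (λ v~w → lookup-injective (setoid _) reps-unique
      (trans (lookup-π v) (trans (rep-cong v~w) (sym (lookup-π w)))))
    where
    rep-≡ : π v ≡ π w → rep v ≡ rep w
    rep-≡ πv≡πw = trans (sym (lookup-π v)) (trans (cong (lookup reps) πv≡πw) (lookup-π w))

  quotient : Quotient _~_
  quotient = record
    { size      = length other-reps
    ; π         = π
    ; section   = lookup reps
    ; π∘section = π∘lookup
    ; π-≡⇔~     = π-≡⇔~
    }

-- The graph 𝒢(ξ) and its strict homomorphisms

module _ (G H : Digraph) (ξ : V G → V H) where
  open Quotient (Representatives.quotient (Γ-isDecEquivalence G H ξ))

  liftedArc? : ∀ a b → Dec (∃ λ v → ∃ λ w → π v ≡ a × π w ≡ b × Arc G v w)
  liftedArc? a b = any? λ v → any? λ w → π v ≟ a ×-dec π w ≟ b ×-dec T? (Digraph.arc G v w)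

  𝒢 : Digraph
  𝒢 = record { size = size ; arc = λ a b → isYes (liftedArc? a b) }

  𝒢-isGraphOf : IsGraphOf G H ξ 𝒢
  𝒢-isGraphOf = π
    , (λ a → section a , π∘section a)
    , (λ v w → ⇔-trans π-≡⇔~ (Γ⇔same-class G H ξ))
    , (λ a b → mk⇔ toWitness fromWitness)

module _ (G H : Digraph) where

  isHom? : (f : V G → V H) → Dec (IsHom G H f)
  isHom? f = all? λ v → all? λ w → T? (Digraph.arc G v w) →-dec T? (Digraph.arc H (f v) (f w))

  IsHom-resp : IsHom G H Respects _≗_
  IsHom-resp f≗g f-hom v w vw = subst₂ (Arc H) (f≗g v) (f≗g w) (f-hom v w vw)

  IsStrictHom-resp : IsStrictHom G H Respects _≗_
  IsStrictHom-resp f≗g (f-hom , f-strict) =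
    IsHom-resp f≗g f-hom ,
    λ v w v≢w vw gv≡gw → f-strict v w v≢w vw (trans (f≗g v) (trans gv≡gw (sym (f≗g w))))

HomWithKernel : (G H : Digraph) {n : ℕ} → (V G → Fin n) → (V G → V H) → Set
HomWithKernel G H ξ f = IsHom G H f × SameAdjacentKernel G ξ f

module _ (G H : Digraph) {n} (ξ : V G → Fin n) where

  homWithKernel? : Decidable (HomWithKernel G H ξ)
  homWithKernel? f = isHom? G H f ×-dec sameAdjacentKernel? ξ f

  HomWithKernel-resp : HomWithKernel G H ξ Respects _≗_
  HomWithKernel-resp f≗g (f-hom , ξ~f) =
    IsHom-resp G H f≗g f-hom , SameAdjacentKernel-trans ξ~f (≗⇒SameAdjacentKernel f≗g)

module _ {G R K : Digraph} {ξ : V G → V R} (K-isGraphOf : IsGraphOf G R ξ K) where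

  private
    π : V G → V K
    π = proj₁ K-isGraphOf

    section : V K → V G
    section a = proj₁ (proj₁ (proj₂ K-isGraphOf) a)

    π∘section : ∀ a → π (section a) ≡ a
    π∘section a = proj₂ (proj₁ (proj₂ K-isGraphOf) a)

    π-≡⇒Γ : ∀ {v w} → π v ≡ π w → Γ G R ξ v w
    π-≡⇒Γ πv≡πw = from (Γ⇔same-class G R ξ) (to (proj₁ (proj₂ (proj₂ K-isGraphOf)) _ _) πv≡πw)

    Γ⇒π-≡ : ∀ {v w} → Γ G R ξ v w → π v ≡ π w
    Γ⇒π-≡ Γvw = from (proj₁ (proj₂ (proj₂ K-isGraphOf)) _ _) (to (Γ⇔same-class G R ξ) Γvw)

    arc-lift : ∀ {a b} → Arc K a b → ∃ λ v → ∃ λ w → π v ≡ a × π w ≡ b × Arc G v w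
    arc-lift = to (proj₂ (proj₂ (proj₂ K-isGraphOf)) _ _)

    π-arc : ∀ {v w} → Arc G v w → Arc K (π v) (π w)
    π-arc vw = from (proj₂ (proj₂ (proj₂ K-isGraphOf)) _ _) (_ , _ , refl , refl , vw)

  module _ (H : Digraph) where

    HomWithKernel-factors : ∀ {f} → HomWithKernel G H ξ f → ∀ v → f (section (π v)) ≡ f v
    HomWithKernel-factors (_ , ξ~f) v =
      proj₁ (Γ-cong {H = R} {H′ = H} ξ~f (π-≡⇒Γ (sym (π∘section (π v)))))

    HomWithKernel⇒IsStrictHom : ∀ {f} → HomWithKernel G H ξ f → IsStrictHom K H (f ∘ section)
    HomWithKernel⇒IsStrictHom {f} f-kh@(f-hom , ξ~f) = hom , strict
      where
      hom : IsHom K H (f ∘ section)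
      hom a b ab with arc-lift ab
      ... | v , w , refl , refl , vw = subst₂ (Arc H)
        (sym (HomWithKernel-factors f-kh v)) (sym (HomWithKernel-factors f-kh w)) (f-hom v w vw)
      strict : ∀ a b → a ≢ b → Arc K a b → f (section a) ≢ f (section b)
      strict a b a≢b ab fa≡fb with arc-lift ab
      ... | v , w , refl , refl , vw =
        a≢b (Γ⇒π-≡ (Γ-adjacent G R ξ (inj₁ vw) (from (ξ~f v w (inj₁ vw)) fv≡fw)))
        where
        fv≡fw : f v ≡ f w
        fv≡fw = trans (sym (HomWithKernel-factors f-kh v)) (trans fa≡fb (HomWithKernel-factors f-kh w))

    IsStrictHom⇒HomWithKernel : ∀ {η} → IsStrictHom K H η → HomWithKernel G H ξ (η ∘ π)
    IsStrictHom⇒HomWithKernel {η} (η-hom , η-strict) = (λ v w vw → η-hom _ _ (π-arc vw)) , ξ~ηπ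
      where
      separates : ∀ {v w} → Adjacent G v w → π v ≢ π w → η (π v) ≢ η (π w)
      separates (inj₁ vw) πv≢πw = η-strict _ _ πv≢πw (π-arc vw)
      separates (inj₂ wv) πv≢πw = η-strict _ _ (πv≢πw ∘ sym) (π-arc wv) ∘ sym
      ξ~ηπ : SameAdjacentKernel G ξ (η ∘ π)
      ξ~ηπ v w adj = mk⇔ (cong η ∘ Γ⇒π-≡ ∘ Γ-adjacent G R ξ adj) reflect
        where
        reflect : η (π v) ≡ η (π w) → ξ v ≡ ξ w
        reflect ηπv≡ηπw with π v ≟ π w
        ... | yes πv≡πw = sym (proj₁ (π-≡⇒Γ πv≡πw))
        ... | no πv≢πw  = contradiction ηπv≡ηπw (separates adj πv≢πw)

    #S≡#HomWithKernel : #S K H ≡ # (homWithKernel? G H ξ)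
    #S≡#HomWithKernel = ≤-antisym
      (#-mono-injection (isStrictHom? K H) (homWithKernel? G H ξ)
        (IsStrictHom-resp K H) (HomWithKernel-resp G H ξ) (_∘ π) IsStrictHom⇒HomWithKernel
        (λ {η} {η′} _ _ ηπ≗η′π a → begin
          η a                 ≡⟨ cong η (π∘section a) ⟨
          η (π (section a))   ≡⟨ ηπ≗η′π (section a) ⟩
          η′ (π (section a))  ≡⟨ cong η′ (π∘section a) ⟩
          η′ a                ∎))
      (#-mono-injection (homWithKernel? G H ξ) (isStrictHom? K H)
        (HomWithKernel-resp G H ξ) (IsStrictHom-resp K H) (_∘ section) HomWithKernel⇒IsStrictHom
        (λ {f} {g} f-kh g-kh f∘section≗g∘section v → begin
          f v                 ≡⟨ HomWithKernel-factors f-kh v ⟨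
          f (section (π v))   ≡⟨ f∘section≗g∘section (π v) ⟩
          g (section (π v))   ≡⟨ HomWithKernel-factors g-kh v ⟩
          g v                 ∎))
      where open ≡-Reasoning

#S-𝒢 : ∀ G R (ξ : V G → V R) H → #S (𝒢 G R ξ) H ≡ # (homWithKernel? G H ξ)
#S-𝒢 G R ξ = #S≡#HomWithKernel {G = G} {R = R} {K = 𝒢 G R ξ} {ξ = ξ} (𝒢-isGraphOf G R ξ)

-- The class-wise embedding ρ

homsWithKernel : (G H : Digraph) {n : ℕ} → (V G → Fin n) → List (V G → V H)
homsWithKernel G H ξ = filter (homWithKernel? G H ξ) (allFuns _ _)

homsWithKernel-cong : ∀ {G H n} {ξ ξ′ : V G → Fin n} → SameAdjacentKernel G ξ ξ′ →
  homsWithKernel G H ξ ≡ homsWithKernel G H ξ′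
homsWithKernel-cong {G} {H} {ξ = ξ} {ξ′} ξ~ξ′ =
  filter-≐ (homWithKernel? G H ξ) (homWithKernel? G H ξ′)
    ( (λ (f-hom , ξ~f) → f-hom , SameAdjacentKernel-trans (SameAdjacentKernel-sym ξ~ξ′) ξ~f)
    , (λ (f-hom , ξ′~f) → f-hom , SameAdjacentKernel-trans ξ~ξ′ ξ′~f) )
    (allFuns _ _)

ΓEmbedding : (G R S : Digraph) → Set
ΓEmbedding G R S =
  Σ (Hom G R → Hom G S) λ ρ →
    (∀ ξ ξ′ → proj₁ (ρ ξ) ≗ proj₁ (ρ ξ′) → proj₁ ξ ≗ proj₁ ξ′)
    × (∀ ξ v u → Γ G S (proj₁ (ρ ξ)) v u ⇔ Γ G R (proj₁ ξ) v u)

module _ (G R S : Digraph)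
  (#R≤#S : ∀ (ξ : Hom G R) →
    # (homWithKernel? G R (proj₁ ξ)) ≤ # (homWithKernel? G S (proj₁ ξ))) where

  ξ∈homsWithKernel : (ξ : Hom G R) → proj₁ ξ ∈ homsWithKernel G R (proj₁ ξ)
  ξ∈homsWithKernel (ξ , ξ-hom) =
    ∈-filter-allFuns (homWithKernel? G R ξ) (HomWithKernel-resp G R ξ) (ξ-hom , SameAdjacentKernel-refl)

  ρ-map : Hom G R → V G → V S
  ρ-map ξ = embed (Maps _ _) (Maps _ _) (homsWithKernel G S (proj₁ ξ)) (#R≤#S ξ) (ξ∈homsWithKernel ξ)

  ρ-map-homWithKernel : ∀ ξ → HomWithKernel G S (proj₁ ξ) (ρ-map ξ)
  ρ-map-homWithKernel ξ = filter-allFuns-satisfies (homWithKernel? G S (proj₁ ξ))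
    (HomWithKernel-resp G S (proj₁ ξ)) (∈-lookup (Maps _ _) (homsWithKernel G S (proj₁ ξ)) _)

  ρ : Hom G R → Hom G S
  ρ ξ = ρ-map ξ , proj₁ (ρ-map-homWithKernel ξ)

  ρ-Γ : ∀ ξ v u → Γ G S (proj₁ (ρ ξ)) v u ⇔ Γ G R (proj₁ ξ) v u
  ρ-Γ ξ v u = mk⇔ (Γ-cong {H = S} {H′ = R} (SameAdjacentKernel-sym ξ~ρξ))
                  (Γ-cong {H = R} {H′ = S} ξ~ρξ)
    where
    ξ~ρξ : SameAdjacentKernel G (proj₁ ξ) (ρ-map ξ)
    ξ~ρξ = proj₂ (ρ-map-homWithKernel ξ)

  ρ-injective : ∀ ξ ξ′ → proj₁ (ρ ξ) ≗ proj₁ (ρ ξ′) → proj₁ ξ ≗ proj₁ ξ′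
  ρ-injective ξ ξ′ ρξ≗ρξ′ = embed-injective (Maps _ _) (Maps _ _)
    (homsWithKernel-cong {H = R} ξ~ξ′) (homsWithKernel-cong {H = S} ξ~ξ′)
    (filter-allFuns-unique (homWithKernel? G S (proj₁ ξ)))
    (#R≤#S ξ) (#R≤#S ξ′) (ξ∈homsWithKernel ξ) (ξ∈homsWithKernel ξ′) ρξ≗ρξ′
    where
    ξ~ξ′ : SameAdjacentKernel G (proj₁ ξ) (proj₁ ξ′)
    ξ~ξ′ = SameAdjacentKernel-trans (proj₂ (ρ-map-homWithKernel ξ))
      (SameAdjacentKernel-trans (≗⇒SameAdjacentKernel ρξ≗ρξ′)
        (SameAdjacentKernel-sym (proj₂ (ρ-map-homWithKernel ξ′))))

  #≤⇒ΓEmbedding : ΓEmbedding G R S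
  #≤⇒ΓEmbedding = ρ , ρ-injective , ρ-Γ

lemma4 : (R S : Digraph) (D : Digraph → Set) →
    (∀ G → D G → (ξ : Hom G R) → (K : Digraph) → IsGraphOf G R (proj₁ ξ) K →
      #S K R ≤ #S K S) →
    R ⊑Γ S wrt D
lemma4 R S D hyp G G∈D = #≤⇒ΓEmbedding G R S λ (ξ , ξ-hom) → begin
  # (homWithKernel? G R ξ)  ≡⟨ #S-𝒢 G R ξ R ⟨
  #S (𝒢 G R ξ) R           ≤⟨ hyp G G∈D (ξ , ξ-hom) (𝒢 G R ξ) (𝒢-isGraphOf G R ξ) ⟩
  #S (𝒢 G R ξ) S           ≡⟨ #S-𝒢 G R ξ S ⟩
  # (homWithKernel? G S ξ)  ∎
  where open ≤-Reasoning
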